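{- Let $S_\infty$ be a set with subsets $S_1\subseteq S_2\subseteq\cdots$, $S_\infty=\bigcup_nS_n$. Let $((\mathrm{cl}_n)_{n\ge1},\mathrm{cl}_\infty)$ be a consistent system of closure operations and $(\varpi,\Pi)$ a consistent system of maps such that $\varpi$ is locally finite and compatible with $(\mathrm{cl}_n)_n$. Let $\mathcal A=(A_n)_{n\ge1}$ be a $\varpi$-invariant, $(\mathrm{cl}_n)$-closed chain whose limit $A_\infty=\bigcup_nA_n$ is $\mathrm{cl}_\infty$-closed. Then the following are equivalent: (a) $\mathcal A$ stabilizes and is eventually finitely generated; (b) $A_\infty$ is $\Pi$-equivariantly finitely generated. Moreover, if either holds, then $\mathcal A$ is eventually saturated.
   Context: A chain of sets is a sequence $(A_n)_{n\ge1}$ with $A_n\subseteq S_n$, $A_n\subseteq A_{n+1}$; limit $A_\infty=\bigcup_nA_n$; eventually saturated if $A_n=A_\infty\cap S_n$ for all large $n$. A closure operation on $X$: $A\mapsto A^{\mathrm{cl}}$ on subsets with $A\subseteq A^{\mathrm{cl}}$, $(A^{\mathrm{cl}})^{\mathrm{cl}}=A^{\mathrm{cl}}$, monotone; $A$ closed if $A^{\mathrm{cl}}=A$. The closure system ($\mathrm{cl}_n$ on $S_n$, $\mathrm{cl}_\infty$ on $S_\infty$) is consistent if $(A\cap S_n)^{\mathrm{cl}_n}=A^{\mathrm{cl}_\infty}\cap S_n$ for all $n$ and $A\subseteq S_\infty$. A system of maps $(\varpi,\Pi)$: a set $\Pi$ of maps $S_\infty\to S_\infty$ and sets $\Pi_{m,n}$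 ($m\le n$) of maps $S_m\to S_n$, $\varpi=\{\Pi_{m,n}\}$; $\Pi_{m,n}(A)$, $\Pi(A)$ denote sets of images. Locally finite: $\Pi_{m,n}(A)$ finite for finite $A\subseteq S_m$. Consistent: $\Pi_{m,n}(A)=\Pi(A)\cap S_n$ for all $n\ge m$, $A\subseteq S_m$. Compatible: $\Pi_{m,n}(A^{\mathrm{cl}_m})\subseteq(\Pi_{m,n}(A))^{\mathrm{cl}_n}$ for all $n\ge m$, $A\subseteq S_m$. The chain is $(\mathrm{cl}_n)$-closed if each $A_n$ is $\mathrm{cl}_n$-closed; $\varpi$-invariant if $(\Pi_{m,n}(A_m))^{\mathrm{cl}_n}\subseteq A_n$ for $n\ge m$; stabilizes if there is $r$ with $(\Pi_{m,n}(A_m))^{\mathrm{cl}_n}=A_n$ for all $n\ge m\ge r$; eventually finitely generated if for large $n$, $A_n=G_n^{\mathrm{cl}_n}$ with $G_n\subseteq A_n$ finite. $A_\infty$ is $\Pi$-equivariantly finitely generated if $A_\infty=\Pi(G)^{\mathrm{cl}_\infty}$ for some finite $G\subseteq A_\infty$. -}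

module Defs where

open import Data.Nat using (ℕ; _≤_)
open import Data.Product using (Σ; ∃; _×_; _,_; proj₁)
open import Data.List using (List)
open import Data.List.Membership.Propositional using (_∈_)
open import Relation.Binary.PropositionalEquality using (_≡_)

Subset : Set → Set₁
Subset X = X → Set

module _ {X : Set} where

  infix 4 _⊆_ _≐_
  _⊆_ : Subset X → Subset X → Set
  A ⊆ B = ∀ x → A x → B x

  _≐_ : Subset X → Subset X → Set
  A ≐ B = (A ⊆ B) × (B ⊆ A)

  _∩_ : Subset X → Subset X → Subset X
  (A ∩ B) x = A x × B x

  ⟦_⟧ : List X → Subset X
  ⟦ L ⟧ x = x ∈ L

  IsFinite : Subset X → Set
  IsFinite A = Σ (List X) λ L → A ≐ ⟦ L ⟧

  record IsClosureOn (T : Subset X) (cl : Subset X → Subset X) : Set₁ where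
    field
      into       : ∀ A → A ⊆ T → cl A ⊆ T
      extensive  : ∀ A → A ⊆ T → A ⊆ cl A
      idempotent : ∀ A → A ⊆ T → cl (cl A) ≐ cl A
      monotone   : ∀ A B → A ⊆ T → B ⊆ T → A ⊆ B → cl A ⊆ cl B

  record IsClosure (cl : Subset X → Subset X) : Set₁ where
    field
      extensive  : ∀ A → A ⊆ cl A
      idempotent : ∀ A → cl (cl A) ≐ cl A
      monotone   : ∀ A B → A ⊆ B → cl A ⊆ cl B

  IsClosed : (Subset X → Subset X) → Subset X → Set
  IsClosed cl A = cl A ≐ A

Img : {X : Set} (S : ℕ → Subset X) {I : Set} {m n : ℕ}
      (π : I → Σ X (S m) → Σ X (S n)) → Subset X → Subset X
Img {X} S {I} {m} π A y =
  Σ I λ i → Σ X λ x → Σ (S m x) λ p → A x × proj₁ (π i (x , p)) ≡ y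

Img∞ : {X : Set} {J : Set} (ρ : J → X → X) → Subset X → Subset X
Img∞ {X} {J} ρ A y = Σ J λ j → Σ X λ x → A x × ρ j x ≡ y

-- If A∞ = cl∞(Π G) with G ⊆ A_k finite, consistency of the closures and of the maps
-- gives A∞ ∩ S_n = cl_n(Π_{k,n} G) ⊆ A_n for every n ≥ k; this yields saturation,
-- stabilization, and (by local finiteness of Π_{k,n} G) finite generation at once.
-- Conversely, if A_k = cl_k(G) and the chain has stabilized by k, compatibility gives
-- A_n = cl_n(Π_{k,n} A_k) ⊆ cl_n(Π_{k,n} G) = cl∞(Π G) ∩ S_n for n ≥ k, and
-- Π G ⊆ A∞ together with closedness of A∞ gives the reverse inclusion.
module Submission where

open import Defs
open import Data.Nat using (ℕ; _≤_; suc; _⊔_; _≤′_; ≤′-refl; ≤′-step)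
open import Data.Nat.Properties using (≤⇒≤′; m≤m⊔n; m≤n⊔m)
open import Data.Product using (Σ; _×_; _,_; proj₁; proj₂; <_,_>)
open import Data.Sum using (_⊎_; [_,_])
open import Data.List using (List; []; _∷_)
open import Data.List.Relation.Unary.Any using (here; there)
open import Function using (_∘_; id)
open import Function.Bundles using (_⇔_; mk⇔)
open import Relation.Binary.PropositionalEquality using (refl)

module _ {X : Set} where

  ⊆-trans : {B C D : Subset X} → B ⊆ C → C ⊆ D → B ⊆ D
  ⊆-trans B⊆C C⊆D x = C⊆D x ∘ B⊆C x

  ≐-trans : {B C D : Subset X} → B ≐ C → C ≐ D → B ≐ D
  ≐-trans (B⊆C , C⊆B) (C⊆D , D⊆C) = ⊆-trans B⊆C C⊆D , ⊆-trans D⊆C C⊆B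

  ⋃ : (ℕ → Subset X) → Subset X
  ⋃ B x = Σ ℕ λ n → B n x

  module _ (B : ℕ → Subset X) (B-step : ∀ n → B n ⊆ B (suc n)) where

    chain-mono′ : ∀ {m n} → m ≤′ n → B m ⊆ B n
    chain-mono′ ≤′-refl       x b = b
    chain-mono′ (≤′-step m≤n) x b = B-step _ x (chain-mono′ m≤n x b)

    chain-mono : ∀ {m n} → m ≤ n → B m ⊆ B n
    chain-mono = chain-mono′ ∘ ≤⇒≤′

    ⟦⟧⊆⋃⇒⊆-stage : (G : List X) → ⟦ G ⟧ ⊆ ⋃ B → Σ ℕ λ k → ⟦ G ⟧ ⊆ B k
    ⟦⟧⊆⋃⇒⊆-stage []      _    = 0 , λ _ ()
    ⟦⟧⊆⋃⇒⊆-stage (g ∷ G) g∷G⊆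
      with g∷G⊆ g (here refl) | ⟦⟧⊆⋃⇒⊆-stage G (λ x → g∷G⊆ x ∘ there)
    ... | n , g∈Bn | k , G⊆Bk = n ⊔ k , g∷G⊆Bn⊔k
      where
        g∷G⊆Bn⊔k : ⟦ g ∷ G ⟧ ⊆ B (n ⊔ k)
        g∷G⊆Bn⊔k x (here refl) = chain-mono (m≤m⊔n n k) x g∈Bn
        g∷G⊆Bn⊔k x (there x∈G) = chain-mono (m≤n⊔m n k) x (G⊆Bk x x∈G)

  module _ {T : Subset X} {cl : Subset X → Subset X} (isCl : IsClosureOn T cl) where
    open IsClosureOn isCl

    cl-cong : ∀ {B C} → B ⊆ T → C ⊆ T → B ≐ C → cl B ≐ cl C
    cl-cong B⊆T C⊆T (B⊆C , C⊆B) = monotone _ _ B⊆T C⊆T B⊆C , monotone _ _ C⊆T B⊆T C⊆B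

    ⊆cl⇒cl⊆cl : ∀ {B C} → B ⊆ T → C ⊆ T → C ⊆ cl B → cl C ⊆ cl B
    ⊆cl⇒cl⊆cl B⊆T C⊆T C⊆clB =
      ⊆-trans (monotone _ _ C⊆T (into _ B⊆T) C⊆clB) (proj₁ (idempotent _ B⊆T))

module _ {X : Set} (S : ℕ → Subset X) {I : Set} {m n : ℕ} (π : I → Σ X (S m) → Σ X (S n)) where

  Img⊆S : ∀ B → Img S π B ⊆ S n
  Img⊆S B y (i , x , x∈S , _ , refl) = proj₂ (π i (x , x∈S))

  Img-mono : ∀ {B C} → B ⊆ C → Img S π B ⊆ Img S π C
  Img-mono B⊆C y (i , x , x∈S , x∈B , eq) = i , x , x∈S , B⊆C x x∈B , eq

module ChainOfClosedSets
    {X : Set}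
    (S : ℕ → Subset X)
    (S-mono : ∀ n → S n ⊆ S (suc n))
    (S-cover : ∀ x → Σ ℕ λ n → S n x)
    (cl : ℕ → Subset X → Subset X)
    (cl∞ : Subset X → Subset X)
    (cl-isClosure : ∀ n → IsClosureOn (S n) (cl n))
    (cl∞-isClosure : IsClosure cl∞)
    (cl-consistent : ∀ n (A : Subset X) → cl n (A ∩ S n) ≐ (cl∞ A ∩ S n))
    {I : ℕ → ℕ → Set}
    (π : ∀ m n → I m n → Σ X (S m) → Σ X (S n))
    {J : Set}
    (ρ : J → X → X)
    (ϖ-locallyFinite : ∀ m n → m ≤ n → (L : List X) → ⟦ L ⟧ ⊆ S m →
       IsFinite (Img S (π m n) ⟦ L ⟧))
    (ϖ-consistent : ∀ m n → m ≤ n → (A : Subset X) → A ⊆ S m →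
       Img S (π m n) A ≐ (Img∞ ρ A ∩ S n))
    (ϖ-compatible : ∀ m n → m ≤ n → (A : Subset X) → A ⊆ S m →
       Img S (π m n) (cl m A) ⊆ cl n (Img S (π m n) A))
    (A : ℕ → Subset X)
    (A⊆S : ∀ n → A n ⊆ S n)
    (A-mono : ∀ n → A n ⊆ A (suc n))
    (A-invariant : ∀ m n → m ≤ n → cl n (Img S (π m n) (A m)) ⊆ A n)
    (A∞-closed : IsClosed cl∞ (⋃ A))
  where

  A∞ : Subset X
  A∞ = ⋃ A

  Stabilizes : Set
  Stabilizes = Σ ℕ λ r → ∀ m n → r ≤ m → m ≤ n → cl n (Img S (π m n) (A m)) ≐ A n

  EventuallyFinitelyGenerated : Set
  EventuallyFinitelyGenerated = Σ ℕ λ N → ∀ n → N ≤ n →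
    Σ (List X) λ G → (⟦ G ⟧ ⊆ A n) × (A n ≐ cl n ⟦ G ⟧)

  EquivariantlyFinitelyGenerated : Set
  EquivariantlyFinitelyGenerated =
    Σ (List X) λ G → (⟦ G ⟧ ⊆ A∞) × (A∞ ≐ cl∞ (Img∞ ρ ⟦ G ⟧))

  EventuallySaturated : Set
  EventuallySaturated = Σ ℕ λ N → ∀ n → N ≤ n → A n ≐ (A∞ ∩ S n)

  private
    module cl n = IsClosureOn (cl-isClosure n)

  Img⊆A : ∀ {m n} → m ≤ n → Img S (π m n) (A m) ⊆ A n
  Img⊆A {m} {n} m≤n =
    ⊆-trans (cl.extensive n _ (Img⊆S S (π m n) (A m))) (A-invariant m n m≤n)

  A⊆A∞∩S : ∀ n → A n ⊆ A∞ ∩ S n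
  A⊆A∞∩S n x x∈A = (n , x∈A) , A⊆S n x x∈A

  cl-Img≐cl∞-Img∞∩S : ∀ {k n B} → k ≤ n → B ⊆ S k →
                      cl n (Img S (π k n) B) ≐ cl∞ (Img∞ ρ B) ∩ S n
  cl-Img≐cl∞-Img∞∩S {k} {n} {B} k≤n B⊆S
    with cl-cong (cl-isClosure n) (Img⊆S S (π k n) B) (λ _ → proj₂)
                 (ϖ-consistent k n k≤n B B⊆S)
       | cl-consistent n (Img∞ ρ B)
  ... | ⊆₁ , ⊇₁ | ⊆₂ , ⊇₂ = ⊆-trans ⊆₁ ⊆₂ , ⊆-trans ⊇₂ ⊇₁

  cl-Img-cl⊆cl-Img : ∀ {k n B} → k ≤ n → B ⊆ S k →
                     cl n (Img S (π k n) (cl k B)) ⊆ cl n (Img S (π k n) B)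
  cl-Img-cl⊆cl-Img {k} {n} {B} k≤n B⊆S =
    ⊆cl⇒cl⊆cl (cl-isClosure n) (Img⊆S S (π k n) B) (Img⊆S S (π k n) (cl k B))
      (ϖ-compatible k n k≤n B B⊆S)

  cl-Img⊆A : ∀ {k n B} → k ≤ n → B ⊆ A k → cl n (Img S (π k n) B) ⊆ A n
  cl-Img⊆A {k} {n} {B} k≤n B⊆A =
    ⊆-trans (cl.monotone n _ _ (Img⊆S S (π k n) B) (Img⊆S S (π k n) (A k))
                         (Img-mono S (π k n) B⊆A))
            (A-invariant k n k≤n)

  Img∞⊆A∞ : ∀ {k B} → B ⊆ A k → Img∞ ρ B ⊆ A∞
  Img∞⊆A∞ {k} {B} B⊆A y y∈ΠB with S-cover y
  ... | n , y∈Sn = n ⊔ k , Img⊆A k≤n⊔k y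
    (Img-mono S (π k (n ⊔ k)) B⊆A y
      (proj₂ (ϖ-consistent k (n ⊔ k) k≤n⊔k B (⊆-trans B⊆A (A⊆S k))) y
        (y∈ΠB , chain-mono S S-mono (m≤m⊔n n k) y y∈Sn)))
    where
      k≤n⊔k = m≤n⊔m n k

  module _ {k B} (B⊆A : B ⊆ A k) (A∞⊆cl∞-Img∞ : A∞ ⊆ cl∞ (Img∞ ρ B)) where

    A∞∩S⊆cl-Img : ∀ {n} → k ≤ n → A∞ ∩ S n ⊆ cl n (Img S (π k n) B)
    A∞∩S⊆cl-Img k≤n x (x∈A∞ , x∈S) =
      proj₂ (cl-Img≐cl∞-Img∞∩S k≤n (⊆-trans B⊆A (A⊆S k))) x (A∞⊆cl∞-Img∞ x x∈A∞ , x∈S)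

    A≐cl-Img : ∀ {n} → k ≤ n → A n ≐ cl n (Img S (π k n) B)
    A≐cl-Img {n} k≤n = ⊆-trans (A⊆A∞∩S n) (A∞∩S⊆cl-Img k≤n) , cl-Img⊆A k≤n B⊆A

    A≐A∞∩S : ∀ {n} → k ≤ n → A n ≐ A∞ ∩ S n
    A≐A∞∩S {n} k≤n = A⊆A∞∩S n , ⊆-trans (A∞∩S⊆cl-Img k≤n) (cl-Img⊆A k≤n B⊆A)

  module _ {k B} (B⊆S : B ⊆ S k) (A⊆clB : A k ⊆ cl k B)
           (stable : ∀ n → k ≤ n → A n ⊆ cl n (Img S (π k n) (A k))) where

    A⊆cl-Img : ∀ {n} → k ≤ n → A n ⊆ cl n (Img S (π k n) B)
    A⊆cl-Img {n} k≤n = ⊆-trans (stable n k≤n)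
      (⊆-trans (cl.monotone n _ _ (Img⊆S S (π k n) (A k)) (Img⊆S S (π k n) (cl k B))
                  (Img-mono S (π k n) A⊆clB))
               (cl-Img-cl⊆cl-Img k≤n B⊆S))

    A∞⊆cl∞-Img∞ : A∞ ⊆ cl∞ (Img∞ ρ B)
    A∞⊆cl∞-Img∞ x (n , x∈A) = proj₁ (proj₁ (cl-Img≐cl∞-Img∞∩S k≤n⊔k B⊆S) x
      (A⊆cl-Img k≤n⊔k x (chain-mono A A-mono (m≤m⊔n n k) x x∈A)))
      where
        k≤n⊔k = m≤n⊔m n k

  equivariant-generators-at-stage : EquivariantlyFinitelyGenerated →
    Σ ℕ λ k → Σ (List X) λ G → (⟦ G ⟧ ⊆ A k) × (A∞ ⊆ cl∞ (Img∞ ρ ⟦ G ⟧))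
  equivariant-generators-at-stage (G , G⊆A∞ , A∞⊆ , _)
    with ⟦⟧⊆⋃⇒⊆-stage A A-mono G G⊆A∞
  ... | k , G⊆A = k , G , G⊆A , A∞⊆

  equivariantlyFinGen⇒saturated : EquivariantlyFinitelyGenerated → EventuallySaturated
  equivariantlyFinGen⇒saturated gen with equivariant-generators-at-stage gen
  ... | k , G , G⊆A , A∞⊆ = k , λ n → A≐A∞∩S G⊆A A∞⊆

  equivariantlyFinGen⇒stabilizes : EquivariantlyFinitelyGenerated → Stabilizes
  equivariantlyFinGen⇒stabilizes gen with equivariant-generators-at-stage gen
  ... | k , G , G⊆A , A∞⊆ = k , λ m n k≤m m≤n →
    let G⊆Am = ⊆-trans G⊆A (chain-mono A A-mono k≤m) in
    A-invariant m n m≤n ,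
    ⊆-trans (proj₁ (A≐cl-Img G⊆Am A∞⊆ m≤n))
            (cl.monotone n _ _ (Img⊆S S (π m n) ⟦ G ⟧) (Img⊆S S (π m n) (A m))
               (Img-mono S (π m n) G⊆Am))

  equivariantlyFinGen⇒eventuallyFinGen :
    EquivariantlyFinitelyGenerated → EventuallyFinitelyGenerated
  equivariantlyFinGen⇒eventuallyFinGen gen with equivariant-generators-at-stage gen
  ... | k , G , G⊆A , A∞⊆ = k , generators
    where
      generators : ∀ n → k ≤ n → Σ (List X) λ L → (⟦ L ⟧ ⊆ A n) × (A n ≐ cl n ⟦ L ⟧)
      generators n k≤n with ϖ-locallyFinite k n k≤n G (⊆-trans G⊆A (A⊆S k))
      ... | L , ΠG≐L = L ,
        ⊆-trans (proj₂ ΠG≐L) (⊆-trans (Img-mono S (π k n) G⊆A) (Img⊆A k≤n)) ,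
        ≐-trans (A≐cl-Img G⊆A A∞⊆ k≤n)
                (cl-cong (cl-isClosure n) (Img⊆S S (π k n) ⟦ G ⟧)
                   (⊆-trans (proj₂ ΠG≐L) (Img⊆S S (π k n) ⟦ G ⟧)) ΠG≐L)

  stabilizes×eventuallyFinGen⇒equivariantlyFinGen :
    Stabilizes × EventuallyFinitelyGenerated → EquivariantlyFinitelyGenerated
  stabilizes×eventuallyFinGen⇒equivariantlyFinGen ((r , stab) , (N , fg))
    with fg (r ⊔ N) (m≤n⊔m r N)
  ... | G , G⊆A , A≐clG = G , G⊆A∞ , A∞⊆ , ⊆-trans cl∞Img∞⊆ (proj₁ A∞-closed)
    where
      k = r ⊔ N
      G⊆A∞ : ⟦ G ⟧ ⊆ A∞
      G⊆A∞ x x∈G = k , G⊆A x x∈G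
      A∞⊆ : A∞ ⊆ cl∞ (Img∞ ρ ⟦ G ⟧)
      A∞⊆ = A∞⊆cl∞-Img∞ (⊆-trans G⊆A (A⊆S k)) (proj₁ A≐clG)
              (λ n k≤n → proj₂ (stab k n (m≤m⊔n r N) k≤n))
      cl∞Img∞⊆ : cl∞ (Img∞ ρ ⟦ G ⟧) ⊆ cl∞ A∞
      cl∞Img∞⊆ = IsClosure.monotone cl∞-isClosure _ _ (Img∞⊆A∞ G⊆A)

corollary2p17 :
  (X : Set)
  -- S n, n : ℕ (index 0 ↔ S₁ of the paper), increasing with union X = S∞
  (S : ℕ → Subset X)
  (S-mono : ∀ n → S n ⊆ S (suc n))
  (S-cover : ∀ x → Σ ℕ λ n → S n x)
  (cl : ℕ → Subset X → Subset X)
  (cl∞ : Subset X → Subset X)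
  (cl-isClosure : ∀ n → IsClosureOn (S n) (cl n))
  (cl∞-isClosure : IsClosure cl∞)
  (cl-consistent : ∀ n (A : Subset X) → cl n (A ∩ S n) ≐ (cl∞ A ∩ S n))
  -- system of maps (ϖ, Π): Π_{m,n} = {π i | i : I m n}, Π = {ρ j | j : J}
  (I : ℕ → ℕ → Set)
  (π : ∀ m n → I m n → Σ X (S m) → Σ X (S n))
  (J : Set)
  (ρ : J → X → X)
  (ϖ-locallyFinite : ∀ m n → m ≤ n → (L : List X) → ⟦ L ⟧ ⊆ S m →
     IsFinite (Img S (π m n) ⟦ L ⟧))
  (ϖ-consistent : ∀ m n → m ≤ n → (A : Subset X) → A ⊆ S m →
     Img S (π m n) A ≐ (Img∞ ρ A ∩ S n))
  (ϖ-compatible : ∀ m n → m ≤ n → (A : Subset X) → A ⊆ S m →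
     Img S (π m n) (cl m A) ⊆ cl n (Img S (π m n) A))
  (A : ℕ → Subset X)
  (A⊆S : ∀ n → A n ⊆ S n)
  (A-mono : ∀ n → A n ⊆ A (suc n))
  (A-invariant : ∀ m n → m ≤ n → cl n (Img S (π m n) (A m)) ⊆ A n)
  (A-closed : ∀ n → IsClosed (cl n) (A n))
  (A∞-closed : IsClosed cl∞ (λ x → Σ ℕ λ n → A n x)) →
  let A∞ : Subset X
      A∞ = λ x → Σ ℕ λ n → A n x
      Stabilizes = Σ ℕ λ r → ∀ m n → r ≤ m → m ≤ n →
                     cl n (Img S (π m n) (A m)) ≐ A n
      EventuallyFinGen = Σ ℕ λ N → ∀ n → N ≤ n →
                     Σ (List X) λ G → (⟦ G ⟧ ⊆ A n) × (A n ≐ cl n ⟦ G ⟧)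
      EquivFinGen = Σ (List X) λ G → (⟦ G ⟧ ⊆ A∞) × (A∞ ≐ cl∞ (Img∞ ρ ⟦ G ⟧))
      EventuallySaturated = Σ ℕ λ N → ∀ n → N ≤ n → A n ≐ (A∞ ∩ S n)
  in ((Stabilizes × EventuallyFinGen) ⇔ EquivFinGen)
     × ((Stabilizes × EventuallyFinGen) ⊎ EquivFinGen → EventuallySaturated)
corollary2p17 X S S-mono S-cover cl cl∞ cl-isClosure cl∞-isClosure cl-consistent
              I π J ρ ϖ-locallyFinite ϖ-consistent ϖ-compatible
              A A⊆S A-mono A-invariant _ A∞-closed =
  mk⇔ stabilizes×eventuallyFinGen⇒equivariantlyFinGen
      < equivariantlyFinGen⇒stabilizes , equivariantlyFinGen⇒eventuallyFinGen > ,
  equivariantlyFinGen⇒saturated ∘ [ stabilizes×eventuallyFinGen⇒equivariantlyFinGen , id ]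
  where
    open ChainOfClosedSets S S-mono S-cover cl cl∞ cl-isClosure cl∞-isClosure cl-consistent
           π ρ ϖ-locallyFinite ϖ-consistent ϖ-compatible A A⊆S A-mono A-invariant A∞-closed
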